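{- Let $k\ge2$, $N\ge1$ and $n=\lfloor\log_k(N(k-1)+1)\rfloor$. The total number of fires is \[F(N,k)=\frac{1}{(k-1)^2}\sum_{m=1}^{n-1}\left(mk^{m+1}-(m+1)k^m+1\right)c_m(N,k).\]
   Context: Fix an integer $k\ge 2$. Let $T_k$ be the infinite rooted $k$-ary tree (every vertex has exactly $k$ children) with one additional self-loop at the root, so every vertex has degree $k+1$. A vertex is on layer $i+1$ if its distance from the root is $i$ (the root is on layer 1). Chip-firing: a vertex with at least $k+1$ chips may fire, sending one chip along each incident edge (a non-root vertex sends one chip to its parent and one to each of its $k$ children; the root sends one chip to each of its $k$ children and one chip to itself along the self-loop). Starting with $N$ chips at the root and none elsewhere, vertices fire until no vertex can fire; this terminates, and the stable configuration and the number of times each vertex fires do not depend on the order of firings. All vertices on the same layer carry the same number of chips in the stable configuration; $c_m(N,k)$ denotes the number of chips on each vertex of layer $m+1$ in the stable configuration. $F(N,k)$ denotes the total number of fires (summed over all vertices). -}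

module Defs where

open import Data.Nat using (ℕ; zero; suc; _+_; _*_; _∸_; _^_; _≤_; _<_)
open import Data.Fin using (Fin; fromℕ<)
open import Data.Fin.Properties using () renaming (_≟_ to _≟ᶠ_)
open import Data.List using (List; []; _∷_; replicate; length)
open import Data.List.Properties using (≡-dec)
open import Relation.Nullary using (Dec; yes; no)
open import Relation.Binary.PropositionalEquality using (_≡_)
open import Data.Nat.Properties using (≤-trans; n≤1+n)

-- Vertices of the infinite rooted k-ary tree T_k: a vertex is the path from
-- the root, written with the LAST step first.  [] is the root; (j ∷ v) is
-- the j-th child of v.  A vertex v has distance (length v) from the root,
-- i.e. it lies on layer (length v + 1).
Vertex : ℕ → Set
Vertex k = List (Fin k)

_≟ᵛ_ : {k : ℕ} → (v w : Vertex k) → Dec (v ≡ w)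
_≟ᵛ_ = ≡-dec _≟ᶠ_

Config : ℕ → Set
Config k = Vertex k → ℕ

selfLoop : {k : ℕ} → Vertex k → Vertex k → ℕ
selfLoop [] [] = 1
selfLoop _  _  = 0

childEdge : {k : ℕ} → Vertex k → Vertex k → ℕ
childEdge v []      = 0
childEdge v (j ∷ u) with u ≟ᵛ v
... | yes _ = 1
... | no  _ = 0

received : {k : ℕ} → Vertex k → Vertex k → ℕ
received v w = selfLoop v w + childEdge v w + childEdge w v

fire : (k : ℕ) → Config k → Vertex k → Config k
fire k c v w with w ≟ᵛ v
... | yes _ = (c w ∸ suc k) + received v w
... | no  _ = c w + received v w

data Fires (k : ℕ) : Config k → List (Vertex k) → Config k → Set where
  done : ∀ {c} → Fires k c [] c
  step : ∀ {c c' v vs} → suc k ≤ c v → Fires k (fire k c v) vs c' → Fires k c (v ∷ vs) c'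

Stable : (k : ℕ) → Config k → Set
Stable k c = ∀ v → c v ≤ k

initial : (k : ℕ) → ℕ → Config k
initial k N []      = N
initial k N (_ ∷ _) = 0

layerVertex : (k : ℕ) → 0 < k → ℕ → Vertex k
layerVertex k p m = replicate m (fromℕ< p)

-- c_m: the number of chips on a vertex of layer m+1 in configuration c
-- (all vertices on a layer carry the same number in the stable configuration)
chipsOnLayer : (k : ℕ) → 2 ≤ k → Config k → ℕ → ℕ
chipsOnLayer k p c m = c (layerVertex k (≤-trans (n≤1+n 1) p) m)

-- Σ_{m=a}^{b} f m  (empty if b < a), defined as Σ over m = a, a+1, ..., a+len-1
sumFrom : ℕ → ℕ → (ℕ → ℕ) → ℕ
sumFrom a zero      f = 0
sumFrom a (suc len) f = f a + sumFrom (suc a) len f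

sum1to : ℕ → (ℕ → ℕ) → ℕ
sum1to n f = sumFrom 1 (n ∸ 1) f

-- The swaps of two labels at a fixed depth are automorphisms of the tree fixing the
-- initial configuration.  By the least action principle (a legal firing sequence fires no
-- vertex more often than any firing vector that stabilises) the firing counts and the final
-- configuration are invariant under them, hence depend only on the layer.  Writing f_m and
-- c_m for these values, conservation at layer m + 1 reads
-- c_{m+1} + (k+1) f_{m+1} = f_m + k f_{m+2}.  Summing it against k^m gives Σ k^m c_m = N,
-- and against b_m = Σ_{j<m} (j+1) k^j it gives Σ b_m c_m = Σ k^m f_m, the total number of
-- fires; (k-1)^2 b_m is the coefficient of the theorem.  Least action also shows that no
-- layer between the root and a nonempty layer is empty, so Σ k^m c_m = N confines the chips
-- to the layers below n.

module Submission where

open import Defs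
open import Data.Nat using (ℕ; zero; suc; pred; _+_; _*_; _∸_; _^_; _≤_; _<_; _⊔_; _≟_; _≤?_;
  z≤n; s≤s; _≤′_; ≤′-refl; ≤′-step)
open import Data.Nat.Properties
open import Data.Nat.Tactic.RingSolver using (solve-∀)
open import Data.Fin using (Fin; zero; suc; fromℕ<)
open import Data.Fin.Properties using () renaming (_≟_ to _≟ᶠ_; suc-injective to Fin-suc-injective)
open import Data.Fin.Permutation.Components using (transpose; transpose-inverse)
import Data.Fin.Permutation as Permutation
open import Data.List using (List; []; _∷_; _∷ʳ_; _++_; [_]; length; replicate)
open import Data.List.Properties
  using (∷-injectiveˡ; ∷-injectiveʳ; ∷ʳ-injectiveˡ; ∷ʳ-injectiveʳ; length-++; ++-assoc; length-replicate)
open import Data.List.Reverse using (reverseView; []; _∶_∶ʳ_)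
open import Algebra.Properties.CommutativeMonoid.Sum +-0-commutativeMonoid
  using (sum; sum-cong-≗; ∑-distrib-+; ∑-permute)
open import Algebra.Properties.CommutativeSemigroup +-commutativeSemigroup
  using (interchange; xy∙z≈xz∙y)
open import Data.Empty using (⊥; ⊥-elim)
open import Data.Sum using (inj₁; inj₂)
open import Function using (_∘_)
open import Relation.Binary.PropositionalEquality hiding ([_])
open import Relation.Nullary using (¬_; yes; no; contradiction)

sumFrom-snoc : ∀ a n (f : ℕ → ℕ) → sumFrom a (suc n) f ≡ sumFrom a n f + f (a + n)
sumFrom-snoc a zero    f = trans (+-identityʳ (f a)) (cong f (sym (+-identityʳ a)))
sumFrom-snoc a (suc n) f = begin
  f a + sumFrom (suc a) (suc n) f              ≡⟨ cong (f a +_) (sumFrom-snoc (suc a) n f) ⟩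
  f a + (sumFrom (suc a) n f + f (suc a + n))  ≡⟨ +-assoc (f a) _ _ ⟨
  f a + sumFrom (suc a) n f + f (suc (a + n))  ≡⟨ cong (λ j → S + f j) (+-suc a n) ⟨
  f a + sumFrom (suc a) n f + f (a + suc n)    ∎
  where
  open ≡-Reasoning
  S : ℕ
  S = f a + sumFrom (suc a) n f

sumFrom-suc : ∀ a n (f : ℕ → ℕ) → sumFrom (suc a) n f ≡ sumFrom a n (f ∘ suc)
sumFrom-suc a zero    f = refl
sumFrom-suc a (suc n) f = cong (f (suc a) +_) (sumFrom-suc (suc a) n f)

*-distribˡ-sumFrom : ∀ c a n (f : ℕ → ℕ) → c * sumFrom a n f ≡ sumFrom a n (λ j → c * f j)
*-distribˡ-sumFrom c a zero    f = *-zeroʳ c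
*-distribˡ-sumFrom c a (suc n) f =
  trans (*-distribˡ-+ c (f a) _) (cong (c * f a +_) (*-distribˡ-sumFrom c (suc a) n f))

sumFrom-cong : ∀ a n {f g : ℕ → ℕ} → (∀ j → f j ≡ g j) → sumFrom a n f ≡ sumFrom a n g
sumFrom-cong a zero    f≗g = refl
sumFrom-cong a (suc n) f≗g = cong₂ _+_ (f≗g a) (sumFrom-cong (suc a) n f≗g)

sumFrom-monoˡ-≤ : ∀ a {m n} (f : ℕ → ℕ) → m ≤ n → sumFrom a m f ≤ sumFrom a n f
sumFrom-monoˡ-≤ a f z≤n       = z≤n
sumFrom-monoˡ-≤ a f (s≤s m≤n) = +-monoʳ-≤ (f a) (sumFrom-monoˡ-≤ (suc a) f m≤n)

sumFrom-vanishing : ∀ {m n} (f : ℕ → ℕ) → m ≤ n → (∀ j → m ≤ j → f j ≡ 0) →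
                    sumFrom 0 n f ≡ sumFrom 0 m f
sumFrom-vanishing {m} {n} f m≤n f≡0 = begin
  sumFrom 0 n f              ≡⟨ cong (λ l → sumFrom 0 l f) (sym (m∸n+n≡m m≤n)) ⟩
  sumFrom 0 (n ∸ m + m) f    ≡⟨ extend (n ∸ m) ⟩
  sumFrom 0 m f              ∎
  where
  open ≡-Reasoning
  extend : ∀ d → sumFrom 0 (d + m) f ≡ sumFrom 0 m f
  extend zero    = refl
  extend (suc d) = begin
    sumFrom 0 (suc (d + m)) f       ≡⟨ sumFrom-snoc 0 (d + m) f ⟩
    sumFrom 0 (d + m) f + f (d + m) ≡⟨ cong₂ _+_ (extend d) (f≡0 (d + m) (m≤n+m m d)) ⟩
    sumFrom 0 m f + 0               ≡⟨ +-identityʳ _ ⟩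
    sumFrom 0 m f                   ∎

sumFrom0≡sum1to : ∀ n (f : ℕ → ℕ) → f 0 ≡ 0 → sumFrom 0 n f ≡ sum1to n f
sumFrom0≡sum1to zero    f f0≡0 = refl
sumFrom0≡sum1to (suc n) f f0≡0 = cong (_+ sumFrom 1 n f) f0≡0

sum-const : ∀ n x → sum {n} (λ _ → x) ≡ n * x
sum-const zero    x = refl
sum-const (suc n) x = cong (x +_) (sum-const n x)

sum-zero : ∀ {n} (f : Fin n → ℕ) → (∀ i → f i ≡ 0) → sum f ≡ 0
sum-zero {n} f f≡0 = trans (sum-cong-≗ f≡0) (trans (sum-const n 0) (*-zeroʳ n))

sum-single : ∀ {n} (f : Fin n → ℕ) j → (∀ i → ¬ i ≡ j → f i ≡ 0) → sum f ≡ f j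
sum-single f zero    f≡0 =
  trans (cong (f zero +_) (sum-zero (f ∘ suc) (λ i → f≡0 (suc i) λ ()))) (+-identityʳ _)
sum-single f (suc j) f≡0 =
  cong₂ _+_ (f≡0 zero λ ()) (sum-single (f ∘ suc) j (λ i i≢j → f≡0 (suc i) (i≢j ∘ Fin-suc-injective)))

module ChipFiring (k : ℕ) where

  indicator : Vertex k → Vertex k → ℕ
  indicator v w with w ≟ᵛ v
  ... | yes _ = 1
  ... | no  _ = 0

  indicator-self : ∀ v → indicator v v ≡ 1
  indicator-self v with v ≟ᵛ v
  ... | yes _   = refl
  ... | no  v≢v = ⊥-elim (v≢v refl)

  indicator-≢ : ∀ {v w} → ¬ w ≡ v → indicator v w ≡ 0
  indicator-≢ {v} {w} w≢v with w ≟ᵛ v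
  ... | yes w≡v = ⊥-elim (w≢v w≡v)
  ... | no  _   = refl

  private
    regroup : ∀ c s x y → c + s * (x + y) ≡ c + s * y + s * x
    regroup = solve-∀

  fireCount : List (Vertex k) → Vertex k → ℕ
  fireCount []       w = 0
  fireCount (v ∷ vs) w = indicator v w + fireCount vs w

  childSum : (Vertex k → ℕ) → Vertex k → ℕ
  childSum h w = sum (λ i → h (i ∷ w))

  -- The self-loop makes the root a neighbour of itself.
  neighbourSum : (Vertex k → ℕ) → Vertex k → ℕ
  neighbourSum h []      = h [] + childSum h []
  neighbourSum h (j ∷ w) = h w + childSum h (j ∷ w)

  neighbourSum-cong : ∀ {g h} → (∀ w → g w ≡ h w) → ∀ w → neighbourSum g w ≡ neighbourSum h w
  neighbourSum-cong g≗h []      = cong₂ _+_ (g≗h []) (sum-cong-≗ (λ i → g≗h (i ∷ [])))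
  neighbourSum-cong g≗h (j ∷ w) = cong₂ _+_ (g≗h w) (sum-cong-≗ (λ i → g≗h (i ∷ j ∷ w)))

  neighbourSum-distrib-+ : ∀ g h w →
    neighbourSum (λ u → g u + h u) w ≡ neighbourSum g w + neighbourSum h w
  neighbourSum-distrib-+ g h []      =
    trans (cong (g [] + h [] +_) (∑-distrib-+ (λ i → g (i ∷ [])) (λ i → h (i ∷ []))))
          (interchange (g []) (h []) (childSum g []) (childSum h []))
  neighbourSum-distrib-+ g h (j ∷ w) =
    trans (cong (g w + h w +_) (∑-distrib-+ (λ i → g (i ∷ j ∷ w)) (λ i → h (i ∷ j ∷ w))))
          (interchange (g w) (h w) (childSum g (j ∷ w)) (childSum h (j ∷ w)))

  neighbourSum-zero : ∀ w → neighbourSum (λ _ → 0) w ≡ 0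
  neighbourSum-zero []      = sum-zero {k} _ (λ _ → refl)
  neighbourSum-zero (j ∷ w) = sum-zero {k} _ (λ _ → refl)

  childEdge≡childSum-indicator : ∀ v w → childEdge w v ≡ childSum (indicator v) w
  childEdge≡childSum-indicator []      w = sym (sum-zero (λ i → indicator [] (i ∷ w)) (λ _ → refl))
  childEdge≡childSum-indicator (j ∷ u) w with u ≟ᵛ w
  ... | yes refl = sym (trans (sum-single (λ i → indicator (j ∷ u) (i ∷ u)) j
                                          (λ i i≢j → indicator-≢ (i≢j ∘ ∷-injectiveˡ)))
                             (indicator-self (j ∷ u)))
  ... | no  u≢w  = sym (sum-zero (λ i → indicator (j ∷ u) (i ∷ w))
                                 (λ i → indicator-≢ (u≢w ∘ sym ∘ ∷-injectiveʳ)))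

  received≡neighbourSum-indicator : ∀ v w → received v w ≡ neighbourSum (indicator v) w
  received≡neighbourSum-indicator v []      =
    cong₂ _+_ (selfLoop-root v) (childEdge≡childSum-indicator v [])
    where
    selfLoop-root : ∀ v → selfLoop v [] + 0 ≡ indicator v []
    selfLoop-root []      = refl
    selfLoop-root (_ ∷ _) = refl
  received≡neighbourSum-indicator v (j ∷ w) =
    cong₂ _+_ (trans (cong (_+ childEdge v (j ∷ w)) (selfLoop-child v)) (childEdge-parent v))
              (childEdge≡childSum-indicator v (j ∷ w))
    where
    selfLoop-child : ∀ v → selfLoop v (j ∷ w) ≡ 0
    selfLoop-child []      = refl
    selfLoop-child (_ ∷ _) = refl
    childEdge-parent : ∀ v → childEdge v (j ∷ w) ≡ indicator v w
    childEdge-parent v with w ≟ᵛ v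
    ... | yes _ = refl
    ... | no  _ = refl

  fire-balance : ∀ c v w → suc k ≤ c v →
    fire k c v w + suc k * indicator v w ≡ c w + neighbourSum (indicator v) w
  fire-balance c v w legal with w ≟ᵛ v
  ... | yes refl = begin
    c w ∸ suc k + received w w + suc k * 1
      ≡⟨ +-rearrange (c w ∸ suc k) (received w w) (suc k) ⟩
    c w ∸ suc k + suc k + received w w
      ≡⟨ cong₂ _+_ (m∸n+n≡m legal) (received≡neighbourSum-indicator w w) ⟩
    c w + neighbourSum (indicator w) w ∎
    where
    open ≡-Reasoning
    +-rearrange : ∀ a r s → a + r + s * 1 ≡ a + s + r
    +-rearrange = solve-∀
  ... | no  _    = trans (cong (c w + received v w +_) (*-zeroʳ (suc k)))
                         (trans (+-identityʳ _) (cong (c w +_) (received≡neighbourSum-indicator v w)))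

  Fires-balance : ∀ {c0 vs c} → Fires k c0 vs c →
    ∀ w → c w + suc k * fireCount vs w ≡ c0 w + neighbourSum (fireCount vs) w
  Fires-balance {c0} done w =
    cong (c0 w +_) (trans (*-zeroʳ (suc k)) (sym (neighbourSum-zero w)))
  Fires-balance {c0} {v ∷ vs} {c} (step legal rest) w = begin
    c w + suc k * (indicator v w + fireCount vs w)
      ≡⟨ regroup (c w) (suc k) (indicator v w) (fireCount vs w) ⟩
    (c w + suc k * fireCount vs w) + suc k * indicator v w
      ≡⟨ cong (_+ suc k * indicator v w) (Fires-balance rest w) ⟩
    fire k c0 v w + neighbourSum (fireCount vs) w + suc k * indicator v w
      ≡⟨ xy∙z≈xz∙y (fire k c0 v w) _ _ ⟩
    fire k c0 v w + suc k * indicator v w + neighbourSum (fireCount vs) w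
      ≡⟨ cong (_+ neighbourSum (fireCount vs) w) (fire-balance c0 v w legal) ⟩
    c0 w + neighbourSum (indicator v) w + neighbourSum (fireCount vs) w
      ≡⟨ +-assoc (c0 w) _ _ ⟩
    c0 w + (neighbourSum (indicator v) w + neighbourSum (fireCount vs) w)
      ≡⟨ cong (c0 w +_) (sym (neighbourSum-distrib-+ (indicator v) (fireCount vs) w)) ⟩
    c0 w + neighbourSum (fireCount (v ∷ vs)) w ∎
    where
    open ≡-Reasoning

  -- Firing every vertex w exactly g w times, starting from c, would end in a stable configuration.
  Stabilises : Config k → (Vertex k → ℕ) → Set
  Stabilises c g = ∀ w → c w + neighbourSum g w ≤ k + suc k * g w

  least-action : ∀ {c0 vs c g} → Fires k c0 vs c → Stabilises c0 g → ∀ w → fireCount vs w ≤ g w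
  least-action done _ w = z≤n
  least-action {c0} {v ∷ vs} {g = g} (step legal rest) stabilises w = begin
    indicator v w + fireCount vs w  ≤⟨ +-monoʳ-≤ (indicator v w) (least-action rest stabilises′ w) ⟩
    indicator v w + g′ w            ≡⟨ split w ⟩
    g w                             ∎
    where
    open ≤-Reasoning
    g′ : Vertex k → ℕ
    g′ u = g u ∸ indicator v u

    g[v]≢0 : ¬ g v ≡ 0
    g[v]≢0 g[v]≡0 = <⇒≱ legal (begin
      c0 v                          ≤⟨ m≤m+n (c0 v) _ ⟩
      c0 v + neighbourSum g v       ≤⟨ stabilises v ⟩
      k + suc k * g v               ≡⟨ cong (λ x → k + suc k * x) g[v]≡0 ⟩
      k + suc k * 0                 ≡⟨ cong (k +_) (*-zeroʳ (suc k)) ⟩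
      k + 0                         ≡⟨ +-identityʳ k ⟩
      k                             ∎)

    split : ∀ u → indicator v u + g′ u ≡ g u
    split u with u ≟ᵛ v
    ... | yes refl = m+[n∸m]≡n (n≢0⇒n>0 g[v]≢0)
    ... | no  _    = refl

    stabilises′ : Stabilises (fire k c0 v) g′
    stabilises′ u = +-cancelʳ-≤ (suc k * indicator v u) _ _ (begin
      fire k c0 v u + neighbourSum g′ u + suc k * indicator v u
        ≡⟨ xy∙z≈xz∙y (fire k c0 v u) _ _ ⟩
      fire k c0 v u + suc k * indicator v u + neighbourSum g′ u
        ≡⟨ cong (_+ neighbourSum g′ u) (fire-balance c0 v u legal) ⟩
      c0 u + neighbourSum (indicator v) u + neighbourSum g′ u
        ≡⟨ +-assoc (c0 u) _ _ ⟩
      c0 u + (neighbourSum (indicator v) u + neighbourSum g′ u)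
        ≡⟨ cong (c0 u +_) (sym (neighbourSum-distrib-+ (indicator v) g′ u)) ⟩
      c0 u + neighbourSum (λ x → indicator v x + g′ x) u
        ≡⟨ cong (c0 u +_) (neighbourSum-cong split u) ⟩
      c0 u + neighbourSum g u
        ≤⟨ stabilises u ⟩
      k + suc k * g u
        ≡⟨ cong (λ x → k + suc k * x) (sym (split u)) ⟩
      k + suc k * (indicator v u + g′ u)
        ≡⟨ regroup k (suc k) (indicator v u) (g′ u) ⟩
      k + suc k * g′ u + suc k * indicator v u ∎)

  -- The last hypothesis says that c + (k+1) δ − neighbourSum δ, the configuration reached by
  -- withholding δ firings, is stable.
  Stabilises-withholding : ∀ {c0 vs c} (δ : Vertex k → ℕ) → Fires k c0 vs c →
    (∀ w → δ w ≤ fireCount vs w) → (∀ w → c w + suc k * δ w ≤ k + neighbourSum δ w) →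
    Stabilises c0 (λ w → fireCount vs w ∸ δ w)
  Stabilises-withholding {c0} {vs} {c} δ fires δ≤f stable w =
    +-cancelʳ-≤ (neighbourSum δ w) _ _ (begin
      c0 w + neighbourSum f′ w + neighbourSum δ w
        ≡⟨ +-assoc (c0 w) _ _ ⟩
      c0 w + (neighbourSum f′ w + neighbourSum δ w)
        ≡⟨ cong (c0 w +_) (sym (neighbourSum-distrib-+ f′ δ w)) ⟩
      c0 w + neighbourSum (λ u → f′ u + δ u) w
        ≡⟨ cong (c0 w +_) (neighbourSum-cong split w) ⟩
      c0 w + neighbourSum (fireCount vs) w
        ≡⟨ Fires-balance fires w ⟨
      c w + suc k * fireCount vs w
        ≡⟨ cong (λ x → c w + suc k * x) (sym (split w)) ⟩
      c w + suc k * (f′ w + δ w)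
        ≡⟨ regroup (c w) (suc k) (f′ w) (δ w) ⟩
      c w + suc k * δ w + suc k * f′ w
        ≤⟨ +-monoˡ-≤ (suc k * f′ w) (stable w) ⟩
      k + neighbourSum δ w + suc k * f′ w
        ≡⟨ xy∙z≈xz∙y k _ _ ⟩
      k + suc k * f′ w + neighbourSum δ w ∎)
    where
    open ≤-Reasoning
    f′ : Vertex k → ℕ
    f′ u = fireCount vs u ∸ δ u
    split : ∀ u → f′ u + δ u ≡ fireCount vs u
    split u = m∸n+n≡m (δ≤f u)

  fireCount-≤-symmetric : ∀ {c0 vs c} (σ : Vertex k → Vertex k) →
    (∀ h w → neighbourSum (h ∘ σ) w ≡ neighbourSum h (σ w)) → (∀ w → c0 (σ w) ≡ c0 w) →
    Fires k c0 vs c → Stable k c → ∀ w → fireCount vs w ≤ fireCount vs (σ w)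
  fireCount-≤-symmetric {c0} {vs} {c} σ neighbourSum-σ c0-σ fires stable =
    least-action fires λ w → begin
      c0 w + neighbourSum (fireCount vs ∘ σ) w
        ≡⟨ cong₂ _+_ (sym (c0-σ w)) (neighbourSum-σ (fireCount vs) w) ⟩
      c0 (σ w) + neighbourSum (fireCount vs) (σ w)
        ≡⟨ Fires-balance fires (σ w) ⟨
      c (σ w) + suc k * fireCount vs (σ w)
        ≤⟨ +-monoˡ-≤ _ (stable (σ w)) ⟩
      k + suc k * fireCount vs (σ w) ∎
    where open ≤-Reasoning

  config-symmetric : ∀ {c0 vs c} (σ : Vertex k → Vertex k) →
    (∀ h w → neighbourSum (h ∘ σ) w ≡ neighbourSum h (σ w)) → (∀ w → c0 (σ w) ≡ c0 w) →
    Fires k c0 vs c → (∀ w → fireCount vs (σ w) ≡ fireCount vs w) → ∀ w → c (σ w) ≡ c w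
  config-symmetric {c0} {vs} {c} σ neighbourSum-σ c0-σ fires f-σ w =
    +-cancelʳ-≡ (suc k * fireCount vs w) _ _ (begin
      c (σ w) + suc k * fireCount vs w
        ≡⟨ cong (λ x → c (σ w) + suc k * x) (f-σ w) ⟨
      c (σ w) + suc k * fireCount vs (σ w)
        ≡⟨ Fires-balance fires (σ w) ⟩
      c0 (σ w) + neighbourSum (fireCount vs) (σ w)
        ≡⟨ cong₂ _+_ (c0-σ w) (sym (neighbourSum-σ (fireCount vs) w)) ⟩
      c0 w + neighbourSum (fireCount vs ∘ σ) w
        ≡⟨ cong (c0 w +_) (neighbourSum-cong f-σ w) ⟩
      c0 w + neighbourSum (fireCount vs) w
        ≡⟨ Fires-balance fires w ⟨
      c w + suc k * fireCount vs w ∎)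
    where open ≡-Reasoning

  swapStep : ℕ → Fin k → Fin k → ℕ → Fin k → Fin k
  swapStep d a b e j with e ≟ d
  ... | yes _ = transpose a b j
  ... | no  _ = j

  -- swapAt d a b exchanges the labels a and b on the edges leaving depth d; the step j of j ∷ w
  -- leaves depth length w.
  swapAt : ℕ → Fin k → Fin k → Vertex k → Vertex k
  swapAt d a b []      = []
  swapAt d a b (j ∷ w) = swapStep d a b (length w) j ∷ swapAt d a b w

  swapStep-≢ : ∀ {d e} a b j → ¬ e ≡ d → swapStep d a b e j ≡ j
  swapStep-≢ {d} {e} a b j e≢d with e ≟ d
  ... | yes e≡d = ⊥-elim (e≢d e≡d)
  ... | no  _   = refl

  swapStep-self : ∀ d a b → swapStep d a b d a ≡ b
  swapStep-self d a b with d ≟ d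
  ... | no d≢d = ⊥-elim (d≢d refl)
  ... | yes _ with a ≟ᶠ a
  ...   | yes _   = refl
  ...   | no  a≢a = ⊥-elim (a≢a refl)

  swapStep-inverse : ∀ d a b e j → swapStep d b a e (swapStep d a b e j) ≡ j
  swapStep-inverse d a b e j with e ≟ d
  ... | yes _ = transpose-inverse b a
  ... | no  _ = refl

  length-swapAt : ∀ d a b w → length (swapAt d a b w) ≡ length w
  length-swapAt d a b []      = refl
  length-swapAt d a b (j ∷ w) = cong suc (length-swapAt d a b w)

  swapAt-inverse : ∀ d a b w → swapAt d b a (swapAt d a b w) ≡ w
  swapAt-inverse d a b []      = refl
  swapAt-inverse d a b (j ∷ w) = cong₂ _∷_
    (trans (cong (λ e → swapStep d b a e (swapStep d a b (length w) j)) (length-swapAt d a b w))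
           (swapStep-inverse d a b (length w) j))
    (swapAt-inverse d a b w)

  swapAt-shallow : ∀ d a b w → length w ≤ d → swapAt d a b w ≡ w
  swapAt-shallow d a b []      _  = refl
  swapAt-shallow d a b (j ∷ w) ≤d = cong₂ _∷_
    (swapStep-≢ a b j (<⇒≢ ≤d)) (swapAt-shallow d a b w (≤-trans (n≤1+n _) ≤d))

  swapAt-++ : ∀ d a b s w → d < length w → swapAt d a b (s ++ w) ≡ s ++ swapAt d a b w
  swapAt-++ d a b []      w d< = refl
  swapAt-++ d a b (j ∷ s) w d< = cong₂ _∷_
    (swapStep-≢ a b j (>⇒≢ (<-≤-trans d< (≤-trans (m≤n+m (length w) (length s))
                                                  (≤-reflexive (sym (length-++ s)))))))
    (swapAt-++ d a b s w d<)

  childSum-swapAt : ∀ d a b h w → childSum (h ∘ swapAt d a b) w ≡ childSum h (swapAt d a b w)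
  childSum-swapAt d a b h w with length w ≟ d
  ... | yes _ = sym (∑-permute (λ i → h (i ∷ swapAt d a b w)) (Permutation.transpose a b))
  ... | no  _ = refl

  neighbourSum-swapAt : ∀ d a b h w →
    neighbourSum (h ∘ swapAt d a b) w ≡ neighbourSum h (swapAt d a b w)
  neighbourSum-swapAt d a b h []      = cong (h [] +_) (childSum-swapAt d a b h [])
  neighbourSum-swapAt d a b h (j ∷ w) = cong (h (swapAt d a b w) +_) (childSum-swapAt d a b h (j ∷ w))

  initial-swapAt : ∀ N d a b w → initial k N (swapAt d a b w) ≡ initial k N w
  initial-swapAt N d a b []      = refl
  initial-swapAt N d a b (_ ∷ _) = refl

  swap-invariant⇒layered : ∀ (h : Vertex k → ℕ) → (∀ d a b w → h (swapAt d a b w) ≡ h w) →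
    ∀ z w → h w ≡ h (replicate (length w) z)
  swap-invariant⇒layered h invariant z = normalise []
    where
    normalise : ∀ s w → h (s ++ w) ≡ h (s ++ replicate (length w) z)
    normalise s []      = refl
    normalise s (j ∷ w) = begin
      h (s ++ j ∷ w)                  ≡⟨ cong h (++-assoc s [ j ] w) ⟨
      h ((s ++ [ j ]) ++ w)           ≡⟨ normalise (s ++ [ j ]) w ⟩
      h ((s ++ [ j ]) ++ zs)          ≡⟨ cong h (++-assoc s [ j ] zs) ⟩
      h (s ++ j ∷ zs)                 ≡⟨ invariant d j z (s ++ j ∷ zs) ⟨
      h (swapAt d j z (s ++ j ∷ zs))  ≡⟨ cong h (swapAt-++ d j z s (j ∷ zs) d<|j∷zs|) ⟩
      h (s ++ swapAt d j z (j ∷ zs))  ≡⟨ cong (λ x → h (s ++ x ∷ swapAt d j z zs)) step-j ⟩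
      h (s ++ z ∷ swapAt d j z zs)    ≡⟨ cong (λ x → h (s ++ z ∷ x)) (swapAt-shallow d j z zs |zs|≤d) ⟩
      h (s ++ z ∷ zs)                 ∎
      where
      open ≡-Reasoning
      d : ℕ
      d = length w
      zs : Vertex k
      zs = replicate d z
      |zs| : length zs ≡ d
      |zs| = length-replicate d
      |zs|≤d : length zs ≤ d
      |zs|≤d = ≤-reflexive |zs|
      d<|j∷zs| : d < length (j ∷ zs)
      d<|j∷zs| = s≤s (≤-reflexive (sym |zs|))
      step-j : swapStep d j z (length zs) j ≡ z
      step-j = trans (cong (λ e → swapStep d j z e j) |zs|) (swapStep-self d j z)

  -- The subtree below the child i of the root consists of the vertices w ∷ʳ i.
  treeSum : ℕ → (Vertex k → ℕ) → ℕ
  treeSum zero    h = 0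
  treeSum (suc T) h = h [] + sum (λ i → treeSum T (λ w → h (w ∷ʳ i)))

  treeSum-cong : ∀ T {g h} → (∀ w → g w ≡ h w) → treeSum T g ≡ treeSum T h
  treeSum-cong zero    g≗h = refl
  treeSum-cong (suc T) g≗h =
    cong₂ _+_ (g≗h []) (sum-cong-≗ (λ i → treeSum-cong T (λ w → g≗h (w ∷ʳ i))))

  treeSum-zero : ∀ T h → (∀ w → h w ≡ 0) → treeSum T h ≡ 0
  treeSum-zero zero    h h≡0 = refl
  treeSum-zero (suc T) h h≡0 =
    cong₂ _+_ (h≡0 []) (sum-zero _ (λ i → treeSum-zero T _ (λ w → h≡0 (w ∷ʳ i))))

  treeSum-distrib-+ : ∀ T g h → treeSum T (λ w → g w + h w) ≡ treeSum T g + treeSum T h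
  treeSum-distrib-+ zero    g h = refl
  treeSum-distrib-+ (suc T) g h = begin
    g [] + h [] + sum (λ i → treeSum T (λ w → g (w ∷ʳ i) + h (w ∷ʳ i)))
      ≡⟨ cong (g [] + h [] +_)
              (sum-cong-≗ (λ i → treeSum-distrib-+ T (λ w → g (w ∷ʳ i)) (λ w → h (w ∷ʳ i)))) ⟩
    g [] + h [] + sum (λ i → treeSum T (λ w → g (w ∷ʳ i)) + treeSum T (λ w → h (w ∷ʳ i)))
      ≡⟨ cong (g [] + h [] +_) (∑-distrib-+ (λ i → treeSum T (λ w → g (w ∷ʳ i))) _) ⟩
    g [] + h [] + (sum (λ i → treeSum T (λ w → g (w ∷ʳ i))) + sum (λ i → treeSum T (λ w → h (w ∷ʳ i))))
      ≡⟨ interchange (g []) (h []) _ _ ⟩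
    treeSum (suc T) g + treeSum (suc T) h ∎
    where open ≡-Reasoning

  length-∷ʳ : ∀ (w : Vertex k) i → length (w ∷ʳ i) ≡ suc (length w)
  length-∷ʳ w i = trans (length-++ w) (+-comm (length w) 1)

  ∷ʳ≢[] : ∀ (w : Vertex k) i → ¬ w ∷ʳ i ≡ []
  ∷ʳ≢[] []      i ()
  ∷ʳ≢[] (_ ∷ _) i ()

  indicator-∷ʳ : ∀ v w i → indicator (v ∷ʳ i) (w ∷ʳ i) ≡ indicator v w
  indicator-∷ʳ v w i with w ≟ᵛ v
  ... | yes refl = indicator-self (w ∷ʳ i)
  ... | no  w≢v  = indicator-≢ (w≢v ∘ ∷ʳ-injectiveˡ w v)

  treeSum-indicator : ∀ T v → length v < T → treeSum T (indicator v) ≡ 1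
  treeSum-indicator (suc T) v v<T with reverseView v
  ... | [] = cong suc (sum-zero _ (λ i → treeSum-zero T _ (λ w → indicator-≢ (∷ʳ≢[] w i))))
  ... | u ∶ _ ∶ʳ j = begin
    indicator (u ∷ʳ j) [] + sum (λ i → treeSum T (λ w → indicator (u ∷ʳ j) (w ∷ʳ i)))
      ≡⟨ cong₂ _+_ (indicator-≢ (∷ʳ≢[] u j ∘ sym)) (sum-single _ j off-branch) ⟩
    treeSum T (λ w → indicator (u ∷ʳ j) (w ∷ʳ j))
      ≡⟨ treeSum-cong T (λ w → indicator-∷ʳ u w j) ⟩
    treeSum T (indicator u)
      ≡⟨ treeSum-indicator T u (≤-pred (subst (_< suc T) (length-∷ʳ u j) v<T)) ⟩
    1 ∎
    where
    open ≡-Reasoning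
    off-branch : ∀ i → ¬ i ≡ j → treeSum T (λ w → indicator (u ∷ʳ j) (w ∷ʳ i)) ≡ 0
    off-branch i i≢j = treeSum-zero T _ (λ w → indicator-≢ (i≢j ∘ ∷ʳ-injectiveʳ w u))

  treeSum-layered : ∀ T (g : ℕ → ℕ) → treeSum T (g ∘ length) ≡ sumFrom 0 T (λ j → k ^ j * g j)
  treeSum-layered zero    g = refl
  treeSum-layered (suc T) g = begin
    g 0 + sum (λ i → treeSum T (λ w → g (length (w ∷ʳ i))))
      ≡⟨ cong (g 0 +_) (sum-cong-≗ (λ i → trans (treeSum-cong T (λ w → cong g (length-∷ʳ w i)))
                                                  (treeSum-layered T (g ∘ suc)))) ⟩
    g 0 + sum {k} (λ _ → sumFrom 0 T (λ j → k ^ j * g (suc j)))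
      ≡⟨ cong (g 0 +_) (sum-const k _) ⟩
    g 0 + k * sumFrom 0 T (λ j → k ^ j * g (suc j))
      ≡⟨ cong₂ _+_ (sym (*-identityˡ (g 0))) (*-distribˡ-sumFrom k 0 T _) ⟩
    1 * g 0 + sumFrom 0 T (λ j → k * (k ^ j * g (suc j)))
      ≡⟨ cong (1 * g 0 +_) (sumFrom-cong 0 T (λ j → sym (*-assoc k (k ^ j) (g (suc j))))) ⟩
    1 * g 0 + sumFrom 0 T (λ j → k ^ suc j * g (suc j))
      ≡⟨ cong (1 * g 0 +_) (sumFrom-suc 0 T (λ j → k ^ j * g j)) ⟨
    sumFrom 0 (suc T) (λ j → k ^ j * g j) ∎
    where open ≡-Reasoning

  depthBound : List (Vertex k) → ℕ
  depthBound []       = 0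
  depthBound (v ∷ vs) = suc (length v) ⊔ depthBound vs

  fireCount-deep : ∀ vs w → depthBound vs ≤ length w → fireCount vs w ≡ 0
  fireCount-deep []       w _ = refl
  fireCount-deep (v ∷ vs) w ≤w = cong₂ _+_
    (indicator-≢ (λ w≡v → <⇒≢ (m⊔n≤o⇒m≤o (suc (length v)) (depthBound vs) ≤w) (cong length (sym w≡v))))
    (fireCount-deep vs w (m⊔n≤o⇒n≤o (suc (length v)) (depthBound vs) ≤w))

  treeSum-fireCount : ∀ T vs → depthBound vs ≤ T → treeSum T (fireCount vs) ≡ length vs
  treeSum-fireCount T []       _   = treeSum-zero T _ (λ _ → refl)
  treeSum-fireCount T (v ∷ vs) ≤T = begin
    treeSum T (λ w → indicator v w + fireCount vs w)
      ≡⟨ treeSum-distrib-+ T (indicator v) (fireCount vs) ⟩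
    treeSum T (indicator v) + treeSum T (fireCount vs)
      ≡⟨ cong₂ _+_ (treeSum-indicator T v (m⊔n≤o⇒m≤o _ (depthBound vs) ≤T))
                   (treeSum-fireCount T vs (m⊔n≤o⇒n≤o (suc (length v)) _ ≤T)) ⟩
    suc (length vs) ∎
    where open ≡-Reasoning

  neighbourSum-layered : ∀ (g : ℕ → ℕ) w →
    neighbourSum (g ∘ length) w ≡ g (pred (length w)) + k * g (suc (length w))
  neighbourSum-layered g []      = cong (g 0 +_) (sum-const k (g 1))
  neighbourSum-layered g (j ∷ w) = cong (g (length w) +_) (sum-const k _)

fireWeight : ℕ → ℕ → ℕ
fireWeight k zero    = 0
fireWeight k (suc m) = fireWeight k m + suc m * k ^ m

module LayerArithmetic (k N : ℕ) (fl cl : ℕ → ℕ)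
  (root-balance  : cl 0 + suc k * fl 0 ≡ N + (fl 0 + k * fl 1))
  (layer-balance : ∀ d → cl (suc d) + suc k * fl (suc d) ≡ fl d + k * fl (suc (suc d)))
  (B : ℕ) (fl-vanishes : ∀ j → B ≤ j → fl j ≡ 0)
  where

  digitSum-telescope : ∀ T →
    sumFrom 0 (suc T) (λ j → k ^ j * cl j) + k ^ suc T * fl T ≡ N + k ^ suc T * fl (suc T)
  digitSum-telescope zero = +-cancelʳ-≡ (fl 0) _ _ (begin
    1 * cl 0 + 0 + k * 1 * fl 0 + fl 0  ≡⟨ tidy (cl 0) (fl 0) k ⟩
    cl 0 + suc k * fl 0                 ≡⟨ root-balance ⟩
    N + (fl 0 + k * fl 1)               ≡⟨ tidy′ N (fl 0) (fl 1) k ⟩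
    N + k * 1 * fl 1 + fl 0             ∎)
    where
    open ≡-Reasoning
    tidy : ∀ c f k → 1 * c + 0 + k * 1 * f + f ≡ c + suc k * f
    tidy = solve-∀
    tidy′ : ∀ n f g k → n + (f + k * g) ≡ n + k * 1 * g + f
    tidy′ = solve-∀
  digitSum-telescope (suc T) = +-cancelʳ-≡ (P * fl (suc T)) _ _ (begin
    sumFrom 0 (suc (suc T)) (λ j → k ^ j * cl j) + k * P * fl (suc T) + P * fl (suc T)
      ≡⟨ cong (λ s → s + k * P * fl (suc T) + P * fl (suc T))
              (sumFrom-snoc 0 (suc T) (λ j → k ^ j * cl j)) ⟩
    S + P * cl (suc T) + k * P * fl (suc T) + P * fl (suc T)
      ≡⟨ collect S P (cl (suc T)) (fl (suc T)) k ⟩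
    S + P * (cl (suc T) + suc k * fl (suc T))
      ≡⟨ cong (λ x → S + P * x) (layer-balance T) ⟩
    S + P * (fl T + k * fl (suc (suc T)))
      ≡⟨ expand S P (fl T) (fl (suc (suc T))) k ⟩
    S + P * fl T + k * P * fl (suc (suc T))
      ≡⟨ cong (_+ k * P * fl (suc (suc T))) (digitSum-telescope T) ⟩
    N + P * fl (suc T) + k * P * fl (suc (suc T))
      ≡⟨ xy∙z≈xz∙y N _ _ ⟩
    N + k * P * fl (suc (suc T)) + P * fl (suc T) ∎)
    where
    open ≡-Reasoning
    P : ℕ
    P = k ^ suc T
    S : ℕ
    S = sumFrom 0 (suc T) (λ j → k ^ j * cl j)
    collect : ∀ S P c f k → S + P * c + k * P * f + P * f ≡ S + P * (c + suc k * f)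
    collect = solve-∀
    expand : ∀ S P f g k → S + P * (f + k * g) ≡ S + P * f + k * P * g
    expand = solve-∀

  weightedSum-telescope : ∀ T →
    sumFrom 0 (suc T) (λ m → fireWeight k m * cl m) + fireWeight k (suc T) * fl T
      ≡ sumFrom 0 (suc T) (λ j → k ^ j * fl j) + k * fireWeight k T * fl (suc T)
  weightedSum-telescope zero = base (cl 0) (fl 0) (fl 1) k
    where
    base : ∀ c f g k → 0 * c + 0 + (0 + 1 * 1) * f ≡ 1 * f + 0 + k * 0 * g
    base = solve-∀
  weightedSum-telescope (suc T) = +-cancelʳ-≡ (suc k * w₁ * fl (suc T)) _ _ (begin
    sumFrom 0 (suc (suc T)) (λ m → fireWeight k m * cl m) + w₂ * fl (suc T) + suc k * w₁ * fl (suc T)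
      ≡⟨ cong (λ s → s + w₂ * fl (suc T) + suc k * w₁ * fl (suc T))
              (sumFrom-snoc 0 (suc T) (λ m → fireWeight k m * cl m)) ⟩
    S + w₁ * cl (suc T) + w₂ * fl (suc T) + suc k * w₁ * fl (suc T)
      ≡⟨ collect S w₁ w₂ (cl (suc T)) (fl (suc T)) k ⟩
    S + w₁ * (cl (suc T) + suc k * fl (suc T)) + w₂ * fl (suc T)
      ≡⟨ cong (λ x → S + w₁ * x + w₂ * fl (suc T)) (layer-balance T) ⟩
    S + w₁ * (fl T + k * fl (suc (suc T))) + w₂ * fl (suc T)
      ≡⟨ expand S w₁ w₂ (fl T) (fl (suc T)) (fl (suc (suc T))) k ⟩
    S + w₁ * fl T + (k * w₁ * fl (suc (suc T)) + w₂ * fl (suc T))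
      ≡⟨ cong (_+ (k * w₁ * fl (suc (suc T)) + w₂ * fl (suc T))) (weightedSum-telescope T) ⟩
    F + k * w₀ * fl (suc T) + (k * w₁ * fl (suc (suc T)) + w₂ * fl (suc T))
      ≡⟨ telescope F w₀ (k ^ T) (fl (suc T)) (fl (suc (suc T))) k T ⟩
    F + k ^ suc T * fl (suc T) + k * w₁ * fl (suc (suc T)) + suc k * w₁ * fl (suc T)
      ≡⟨ cong (λ s → s + k * w₁ * fl (suc (suc T)) + suc k * w₁ * fl (suc T))
              (sumFrom-snoc 0 (suc T) (λ j → k ^ j * fl j)) ⟨
    sumFrom 0 (suc (suc T)) (λ j → k ^ j * fl j) + k * w₁ * fl (suc (suc T)) + suc k * w₁ * fl (suc T) ∎)
    where
    open ≡-Reasoning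
    w₀ : ℕ
    w₀ = fireWeight k T
    w₁ : ℕ
    w₁ = fireWeight k (suc T)
    w₂ : ℕ
    w₂ = fireWeight k (suc (suc T))
    S : ℕ
    S = sumFrom 0 (suc T) (λ m → fireWeight k m * cl m)
    F : ℕ
    F = sumFrom 0 (suc T) (λ j → k ^ j * fl j)
    collect : ∀ S w₁ w₂ c f k →
      S + w₁ * c + w₂ * f + suc k * w₁ * f ≡ S + w₁ * (c + suc k * f) + w₂ * f
    collect = solve-∀
    expand : ∀ S w₁ w₂ f₀ f₁ f₂ k →
      S + w₁ * (f₀ + k * f₂) + w₂ * f₁ ≡ S + w₁ * f₀ + (k * w₁ * f₂ + w₂ * f₁)
    expand = solve-∀
    telescope : ∀ F w P f₁ f₂ k t →
      F + k * w * f₁ + (k * (w + suc t * P) * f₂ + (w + suc t * P + suc (suc t) * (k * P)) * f₁)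
        ≡ F + k * P * f₁ + k * (w + suc t * P) * f₂ + suc k * (w + suc t * P) * f₁
    telescope = solve-∀

  fl[2+m]≤fl[1+m]⇒cl[1+m]+fl[1+m]≤fl[m] : ∀ m →
    fl (suc (suc m)) ≤ fl (suc m) → cl (suc m) + fl (suc m) ≤ fl m
  fl[2+m]≤fl[1+m]⇒cl[1+m]+fl[1+m]≤fl[m] m fl-step = +-cancelʳ-≤ (k * fl (suc m)) _ _ (begin
    cl (suc m) + fl (suc m) + k * fl (suc m)  ≡⟨ +-assoc (cl (suc m)) _ _ ⟩
    cl (suc m) + suc k * fl (suc m)           ≡⟨ layer-balance m ⟩
    fl m + k * fl (suc (suc m))               ≤⟨ +-monoʳ-≤ (fl m) (*-monoʳ-≤ k fl-step) ⟩
    fl m + k * fl (suc m)                     ∎)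
    where open ≤-Reasoning

  -- By downward induction from the layers where nothing fires.
  cl[1+m]+fl[1+m]≤fl[m] : ∀ m → cl (suc m) + fl (suc m) ≤ fl m
  cl[1+m]+fl[1+m]≤fl[m] m = below B m (m≤m+n B m)
    where
    below : ∀ d m → B ≤ d + m → cl (suc m) + fl (suc m) ≤ fl m
    below zero    m B≤m   = fl[2+m]≤fl[1+m]⇒cl[1+m]+fl[1+m]≤fl[m] m (≤-reflexive (trans
      (fl-vanishes (suc (suc m)) (≤-trans B≤m (≤-trans (n≤1+n m) (n≤1+n (suc m)))))
      (sym (fl-vanishes (suc m) (≤-trans B≤m (n≤1+n m))))))
    below (suc d) m B≤d+m = fl[2+m]≤fl[1+m]⇒cl[1+m]+fl[1+m]≤fl[m] m
      (≤-trans (m≤n+m _ _) (below d (suc m) (≤-trans B≤d+m (≤-reflexive (sym (+-suc d m))))))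

  fl-antitone : ∀ {i j} → i ≤ j → fl j ≤ fl i
  fl-antitone i≤j = antitone′ (≤⇒≤′ i≤j)
    where
    antitone′ : ∀ {i j} → i ≤′ j → fl j ≤ fl i
    antitone′ ≤′-refl         = ≤-refl
    antitone′ (≤′-step i≤′j) = ≤-trans (≤-trans (m≤n+m _ _) (cl[1+m]+fl[1+m]≤fl[m] _)) (antitone′ i≤′j)

  private
    vanish-after : ∀ {T} (x : ℕ) → B ≤ T → x * fl T ≡ 0
    vanish-after {T} x B≤T = trans (cong (x *_) (fl-vanishes T B≤T)) (*-zeroʳ x)

    drop-zeros : ∀ {a b x y} → a + x ≡ b + y → x ≡ 0 → y ≡ 0 → a ≡ b
    drop-zeros {a} {b} a+x≡b+y refl refl = trans (sym (+-identityʳ a)) (trans a+x≡b+y (+-identityʳ b))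

  digitSum≡N : ∀ T → B ≤ T → sumFrom 0 (suc T) (λ j → k ^ j * cl j) ≡ N
  digitSum≡N T B≤T = drop-zeros (digitSum-telescope T)
    (vanish-after (k ^ suc T) B≤T) (vanish-after (k ^ suc T) (≤-trans B≤T (n≤1+n T)))

  weightedSum≡fireSum : ∀ T → B ≤ T →
    sumFrom 0 (suc T) (λ m → fireWeight k m * cl m) ≡ sumFrom 0 (suc T) (λ j → k ^ j * fl j)
  weightedSum≡fireSum T B≤T = drop-zeros (weightedSum-telescope T)
    (vanish-after (fireWeight k (suc T)) B≤T) (vanish-after (k * fireWeight k T) (≤-trans B≤T (n≤1+n T)))

fireWeight-balance : ∀ K m →
  K ^ 2 * fireWeight (suc K) m + (m + 1) * suc K ^ m ≡ m * suc K ^ suc m + 1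
fireWeight-balance K zero    = cong (_+ 1) (*-zeroʳ (K ^ 2))
fireWeight-balance K (suc m) = +-cancelʳ-≡ ((m + 1) * P) _ _ (begin
  K ^ 2 * (w + suc m * P) + (suc m + 1) * (k * P) + (m + 1) * P
    ≡⟨ regroup K m w P ⟩
  (K ^ 2 * w + (m + 1) * P) + ((m + 1) * (K ^ 2 * P) + (m + 2) * (k * P))
    ≡⟨ cong (_+ ((m + 1) * (K ^ 2 * P) + (m + 2) * (k * P))) (fireWeight-balance K m) ⟩
  (m * (k * P) + 1) + ((m + 1) * (K ^ 2 * P) + (m + 2) * (k * P))
    ≡⟨ close K m P ⟩
  suc m * (k * (k * P)) + 1 + (m + 1) * P ∎)
  where
  open ≡-Reasoning
  k : ℕ
  k = suc K
  w : ℕ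
  w = fireWeight k m
  P : ℕ
  P = k ^ m
  regroup : ∀ K m w p →
    K * (K * 1) * (w + suc m * p) + (suc m + 1) * (suc K * p) + (m + 1) * p
      ≡ (K * (K * 1) * w + (m + 1) * p) + ((m + 1) * (K * (K * 1) * p) + (m + 2) * (suc K * p))
  regroup = solve-∀
  close : ∀ K m p →
    (m * (suc K * p) + 1) + ((m + 1) * (K * (K * 1) * p) + (m + 2) * (suc K * p))
      ≡ suc m * (suc K * (suc K * p)) + 1 + (m + 1) * p
  close = solve-∀

coefficient≡fireWeight : ∀ K m →
  (m * suc K ^ suc m + 1) ∸ (m + 1) * suc K ^ m ≡ K ^ 2 * fireWeight (suc K) m
coefficient≡fireWeight K m = begin
  (m * suc K ^ suc m + 1) ∸ (m + 1) * suc K ^ m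
    ≡⟨ cong (_∸ (m + 1) * suc K ^ m) (fireWeight-balance K m) ⟨
  (K ^ 2 * fireWeight (suc K) m + (m + 1) * suc K ^ m) ∸ (m + 1) * suc K ^ m
    ≡⟨ m+n∸n≡m (K ^ 2 * fireWeight (suc K) m) ((m + 1) * suc K ^ m) ⟩
  K ^ 2 * fireWeight (suc K) m ∎
  where open ≡-Reasoning

digitSum-lower : ∀ K (c : ℕ → ℕ) J → (∀ i → i < J → 1 ≤ c i) →
  suc K ^ J ≤ K * sumFrom 0 J (λ i → suc K ^ i * c i) + 1
digitSum-lower K c zero    _        = ≤-reflexive (cong (_+ 1) (sym (*-zeroʳ K)))
digitSum-lower K c (suc J) positive = begin
  suc K ^ suc J                         ≡⟨ split K (suc K ^ J) ⟩
  K * (suc K ^ J * 1) + suc K ^ J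
    ≤⟨ +-mono-≤ (*-monoʳ-≤ K (*-monoʳ-≤ (suc K ^ J) (positive J ≤-refl)))
                (digitSum-lower K c J (λ i i<J → positive i (≤-trans i<J (n≤1+n J)))) ⟩
  K * (suc K ^ J * c J) + (K * S + 1)   ≡⟨ merge K S (suc K ^ J * c J) ⟩
  K * (S + suc K ^ J * c J) + 1
    ≡⟨ cong (λ s → K * s + 1) (sumFrom-snoc 0 J (λ i → suc K ^ i * c i)) ⟨
  K * sumFrom 0 (suc J) (λ i → suc K ^ i * c i) + 1 ∎
  where
  open ≤-Reasoning
  S : ℕ
  S = sumFrom 0 J (λ i → suc K ^ i * c i)
  split : ∀ K p → suc K * p ≡ K * (p * 1) + p
  split = solve-∀
  merge : ∀ K s x → K * x + (K * s + 1) ≡ K * (s + x) + 1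
  merge = solve-∀

module Stabilisation (K N : ℕ) {vs : List (Vertex (suc K))} {c : Config (suc K)}
  (fires : Fires (suc K) (initial (suc K) N) vs c) (stable : Stable (suc K) c) (z : Fin (suc K))
  where

  open ChipFiring (suc K)

  k : ℕ
  k = suc K

  fl cl : ℕ → ℕ
  fl m = fireCount vs (replicate m z)
  cl m = c (replicate m z)

  fireCount-swapAt : ∀ d a b w → fireCount vs (swapAt d a b w) ≡ fireCount vs w
  fireCount-swapAt d a b w = ≤-antisym
    (subst (λ u → fireCount vs (swapAt d a b w) ≤ fireCount vs u) (swapAt-inverse d a b w)
           (fireCount-≤-swapAt d b a (swapAt d a b w)))
    (fireCount-≤-swapAt d a b w)
    where
    fireCount-≤-swapAt : ∀ d a b w → fireCount vs w ≤ fireCount vs (swapAt d a b w)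
    fireCount-≤-swapAt d a b = fireCount-≤-symmetric
      (swapAt d a b) (neighbourSum-swapAt d a b) (initial-swapAt N d a b) fires stable

  fireCount-layered : ∀ w → fireCount vs w ≡ fl (length w)
  fireCount-layered = swap-invariant⇒layered (fireCount vs) fireCount-swapAt z

  config-layered : ∀ w → c w ≡ cl (length w)
  config-layered = swap-invariant⇒layered c
    (λ d a b → config-symmetric (swapAt d a b) (neighbourSum-swapAt d a b) (initial-swapAt N d a b)
                                fires (fireCount-swapAt d a b)) z

  layered-balance : ∀ d →
    cl d + suc k * fl d ≡ initial k N (replicate d z) + (fl (pred d) + k * fl (suc d))
  layered-balance d = begin
    cl d + suc k * fl d
      ≡⟨ Fires-balance fires zs ⟩
    initial k N zs + neighbourSum (fireCount vs) zs
      ≡⟨ cong (initial k N zs +_) (neighbourSum-cong fireCount-layered zs) ⟩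
    initial k N zs + neighbourSum (fl ∘ length) zs
      ≡⟨ cong (initial k N zs +_) (neighbourSum-layered fl zs) ⟩
    initial k N zs + (fl (pred (length zs)) + k * fl (suc (length zs)))
      ≡⟨ cong (λ e → initial k N zs + (fl (pred e) + k * fl (suc e))) (length-replicate d) ⟩
    initial k N zs + (fl (pred d) + k * fl (suc d)) ∎
    where
    open ≡-Reasoning
    zs : Vertex k
    zs = replicate d z

  fl-vanishes : ∀ j → depthBound vs ≤ j → fl j ≡ 0
  fl-vanishes j B≤j =
    fireCount-deep vs (replicate j z) (subst (depthBound vs ≤_) (sym (length-replicate j)) B≤j)

  open LayerArithmetic k N fl cl (layered-balance 0) (layered-balance ∘ suc) (depthBound vs) fl-vanishes
    public

  length≡fireSum : ∀ T → depthBound vs ≤ T → length vs ≡ sumFrom 0 T (λ j → k ^ j * fl j)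
  length≡fireSum T B≤T = begin
    length vs                          ≡⟨ treeSum-fireCount T vs B≤T ⟨
    treeSum T (fireCount vs)           ≡⟨ treeSum-cong T fireCount-layered ⟩
    treeSum T (fl ∘ length)            ≡⟨ treeSum-layered T fl ⟩
    sumFrom 0 T (λ j → k ^ j * fl j)   ∎
    where open ≡-Reasoning

  ball : ℕ → ℕ → ℕ
  ball m d with d ≤? m
  ... | yes _ = 1
  ... | no  _ = 0

  ball-in : ∀ {m d} → d ≤ m → ball m d ≡ 1
  ball-in {m} {d} d≤m with d ≤? m
  ... | yes _   = refl
  ... | no  d≰m = contradiction d≤m d≰m

  ball-stable : ∀ m → cl m ≡ 0 →
    ∀ d → cl d + suc k * ball m d ≤ k + (ball m (pred d) + k * ball m (suc d))
  ball-stable m cl[m]≡0 d with d ≤? m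
  ... | no d≰m = begin
    cl d + suc k * 0     ≡⟨ cong (cl d +_) (*-zeroʳ (suc k)) ⟩
    cl d + 0             ≡⟨ +-identityʳ (cl d) ⟩
    cl d                 ≤⟨ stable (replicate d z) ⟩
    k                    ≤⟨ m≤m+n k _ ⟩
    k + _                ∎
    where open ≤-Reasoning
  ... | yes d≤m rewrite ball-in {m} {pred d} (≤-trans pred[n]≤n d≤m) with m≤n⇒m<n∨m≡n d≤m
  ...   | inj₁ d<m rewrite ball-in d<m = begin
    cl d + suc k * 1     ≤⟨ +-monoˡ-≤ _ (stable (replicate d z)) ⟩
    k + suc k * 1        ≡⟨ cong (k +_) (*-identityʳ (suc k)) ⟩
    k + (1 + k)          ≡⟨ cong (λ x → k + (1 + x)) (*-identityʳ k) ⟨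
    k + (1 + k * 1)      ∎
    where open ≤-Reasoning
  ...   | inj₂ refl = begin
    cl d + suc k * 1     ≡⟨ cong (_+ suc k * 1) cl[m]≡0 ⟩
    suc k * 1            ≡⟨ *-identityʳ (suc k) ⟩
    1 + k                ≡⟨ +-comm 1 k ⟩
    k + 1                ≤⟨ +-monoʳ-≤ k (m≤m+n 1 _) ⟩
    k + (1 + k * _)      ∎
    where open ≤-Reasoning

  -- Withholding one firing at every vertex of depth ≤ m would still stabilise, contradicting
  -- least action.
  no-firing-gap : ∀ m → cl m ≡ 0 → (∀ d → d ≤ m → 1 ≤ fl d) → ⊥
  no-firing-gap m cl[m]≡0 fired =
    <⇒≱ (∸-monoʳ-< {o = 0} (s≤s z≤n) (fired 0 z≤n)) (least-action fires withheld-stabilises [])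
    where
    δ : Vertex k → ℕ
    δ w = ball m (length w)

    δ≤fireCount : ∀ w → δ w ≤ fireCount vs w
    δ≤fireCount w with length w ≤? m
    ... | yes ≤m = subst (1 ≤_) (sym (fireCount-layered w)) (fired (length w) ≤m)
    ... | no  _  = z≤n

    withheld-stabilises : Stabilises (initial k N) (λ w → fireCount vs w ∸ δ w)
    withheld-stabilises = Stabilises-withholding δ fires δ≤fireCount λ w → begin
      c w + suc k * δ w
        ≡⟨ cong (_+ suc k * δ w) (config-layered w) ⟩
      cl (length w) + suc k * δ w
        ≤⟨ ball-stable m cl[m]≡0 (length w) ⟩
      k + (ball m (pred (length w)) + k * ball m (suc (length w)))
        ≡⟨ cong (k +_) (neighbourSum-layered (ball m) w) ⟨
      k + neighbourSum δ w ∎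
      where open ≤-Reasoning

  chips-positive-below : ∀ {i j} → i ≤ j → 1 ≤ cl j → 1 ≤ cl i
  chips-positive-below {i} {j} i≤j 1≤cl[j] = n≢0⇒n>0 λ cl[i]≡0 → case cl[i]≡0 (m≤n⇒m<n∨m≡n i≤j)
    where
    case : cl i ≡ 0 → _ → ⊥
    case cl[i]≡0 (inj₂ refl)          = <⇒≱ 1≤cl[j] (≤-reflexive cl[i]≡0)
    case cl[i]≡0 (inj₁ (s≤s {n = j′} i≤j′)) = no-firing-gap i cl[i]≡0 λ d d≤i → begin
      1                          ≤⟨ 1≤cl[j] ⟩
      cl j                       ≤⟨ m≤m+n (cl j) (fl j) ⟩
      cl j + fl j                ≤⟨ cl[1+m]+fl[1+m]≤fl[m] j′ ⟩
      fl j′                      ≤⟨ fl-antitone (≤-trans d≤i i≤j′) ⟩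
      fl d                       ∎
      where open ≤-Reasoning

  cl-vanishes : ∀ n → N * K + 1 < k ^ suc n → ∀ j → n ≤ j → cl j ≡ 0
  cl-vanishes n N<k^[1+n] j n≤j = n≤0⇒n≡0 (≮⇒≥ λ 1≤cl[j] → <⇒≱ N<k^[1+n] (begin
    k ^ suc n
      ≤⟨ ^-monoʳ-≤ k (s≤s n≤j) ⟩
    k ^ suc j
      ≤⟨ digitSum-lower K cl (suc j) (λ i i<1+j → chips-positive-below (≤-pred i<1+j) 1≤cl[j]) ⟩
    K * sumFrom 0 (suc j) (λ i → k ^ i * cl i) + 1
      ≤⟨ +-monoˡ-≤ 1 (*-monoʳ-≤ K (sumFrom-monoˡ-≤ 0 _ (s≤s (m≤m+n j B)))) ⟩
    K * sumFrom 0 (suc (j + B)) (λ i → k ^ i * cl i) + 1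
      ≡⟨ cong (λ x → K * x + 1) (digitSum≡N (j + B) (m≤n+m B j)) ⟩
    K * N + 1
      ≡⟨ cong (_+ 1) (*-comm K N) ⟩
    N * K + 1 ∎))
    where
    open ≤-Reasoning
    B : ℕ
    B = depthBound vs

mainTheorem10 : (k : ℕ) → (hk : 2 ≤ k) → (N : ℕ) → 1 ≤ N →
    (n : ℕ) → k ^ n ≤ N * (k ∸ 1) + 1 → N * (k ∸ 1) + 1 < k ^ (suc n) →
    (fs : List (Vertex k)) → (c : Config k) →
    Fires k (initial k N) fs c → Stable k c →
    (k ∸ 1) ^ 2 * length fs
      ≡ sum1to n (λ m → ((m * k ^ (suc m) + 1) ∸ (m + 1) * k ^ m) * chipsOnLayer k (hk) c m)
mainTheorem10 zero          ()
mainTheorem10 (suc zero)    (s≤s ())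
mainTheorem10 (suc (suc K)) hk N _ n _ N<k^[1+n] fs c fires stable = begin
  suc K ^ 2 * length fs
    ≡⟨ cong (suc K ^ 2 *_) (length≡fireSum (suc T) B≤1+T) ⟩
  suc K ^ 2 * sumFrom 0 (suc T) (λ j → k ^ j * fl j)
    ≡⟨ cong (suc K ^ 2 *_) (weightedSum≡fireSum T B≤T) ⟨
  suc K ^ 2 * sumFrom 0 (suc T) (λ m → fireWeight k m * cl m)
    ≡⟨ *-distribˡ-sumFrom (suc K ^ 2) 0 (suc T) _ ⟩
  sumFrom 0 (suc T) (λ m → suc K ^ 2 * (fireWeight k m * cl m))
    ≡⟨ sumFrom-cong 0 (suc T) (λ m → trans (sym (*-assoc (suc K ^ 2) (fireWeight k m) (cl m)))
                                           (cong (_* cl m) (sym (coefficient≡fireWeight (suc K) m)))) ⟩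
  sumFrom 0 (suc T) (λ m → a m * cl m)
    ≡⟨ sumFrom-vanishing _ n≤1+T
         (λ j n≤j → trans (cong (a j *_) (cl-vanishes n N<k^[1+n] j n≤j)) (*-zeroʳ (a j))) ⟩
  sumFrom 0 n (λ m → a m * cl m)
    ≡⟨ sumFrom0≡sum1to n _ refl ⟩
  sum1to n (λ m → a m * cl m) ∎
  where
  open Stabilisation (suc K) N fires stable (fromℕ< (≤-trans (n≤1+n 1) hk))
  open ChipFiring (suc (suc K)) using (depthBound)
  open ≡-Reasoning
  T : ℕ
  T = depthBound fs + n
  B≤T : depthBound fs ≤ T
  B≤T = m≤m+n (depthBound fs) n
  B≤1+T : depthBound fs ≤ suc T
  B≤1+T = ≤-trans B≤T (n≤1+n T)
  n≤1+T : n ≤ suc T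
  n≤1+T = ≤-trans (m≤n+m n (depthBound fs)) (n≤1+n T)
  a : ℕ → ℕ
  a m = (m * k ^ suc m + 1) ∸ (m + 1) * k ^ m
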